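{- Let $G$ be a graph on $n$ vertices with no isolated vertices, and let $k$ be an integer with $1\le k \leq \left\lfloor \frac{n}{2}\right\rfloor$. Then $$\alpha(T_k(G)) \leq \frac{1}{k}\binom{n}{k-1}\alpha(G).$$ Moreover, if equality occurs, then there exists a $t$-$(n,k,\lambda)$ design with $t=k-1$ and $\lambda=\alpha(G)$.
   Context: All graphs are finite and simple. For a graph $G$ with vertex set $V$ of size $n$ and $1\le k\le n-1$, the $k$-token graph $T_k(G)$ has as vertices the $k$-subsets of $V$, two of them adjacent if their symmetric difference is an edge of $G$. $\alpha(\Gamma)$ denotes the independence number of a graph $\Gamma$ (maximum size of a set of pairwise non-adjacent vertices). A $t$-$(v,k,\lambda)$ design is a collection of $k$-subsets of a $v$-element set such that every $t$-subset is contained in exactly $\lambda$ of these $k$-subsets. -}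

module Defs where

open import Level using (0ℓ)
open import Data.Nat using (ℕ; _≤_)
open import Data.Fin using (Fin)
open import Data.Fin.Subset using (Subset; _─_; _∪_; ⁅_⁆; ∣_∣; _⊆_)
open import Data.Fin.Subset.Properties using (_⊆?_)
open import Data.Product using (Σ; ∃; ∃-syntax; _×_; _,_)
open import Data.List using (List; length; filter)
open import Data.List.Relation.Unary.All using (All)
open import Data.List.Relation.Unary.Unique.Propositional using (Unique)
open import Data.List.Relation.Unary.AllPairs using (AllPairs)
open import Data.List.Membership.Propositional using (_∈_)
open import Relation.Nullary using (¬_; Dec)
open import Relation.Binary.PropositionalEquality using (_≡_)

record Graph (n : ℕ) : Set₁ where
  field
    Adj     : Fin n → Fin n → Set
    Adj?    : ∀ u v → Dec (Adj u v)
    sym     : ∀ {u v} → Adj u v → Adj v u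
    irrefl  : ∀ {u} → ¬ Adj u u
open Graph public

NoIsolatedVertices : ∀ {n} → Graph n → Set
NoIsolatedVertices G = ∀ u → ∃[ v ] Adj G u v

IsIndependentSet : {V : Set} → (V → V → Set) → List V → Set
IsIndependentSet R xs = Unique xs × AllPairs (λ x y → ¬ R x y) xs

IsIndependenceNumber : {V : Set} → (V → V → Set) → ℕ → Set
IsIndependenceNumber {V} R m =
  (∃[ xs ] (IsIndependentSet R xs × length xs ≡ m)) ×
  (∀ (xs : List V) → IsIndependentSet R xs → length xs ≤ m)

_△_ : ∀ {n} → Subset n → Subset n → Subset n
A △ B = (A ─ B) ∪ (B ─ A)

TokenVertex : ℕ → ℕ → Set
TokenVertex n k = Σ (Subset n) (λ A → ∣ A ∣ ≡ k)

TokenAdj : ∀ {n} → Graph n → (k : ℕ) → TokenVertex n k → TokenVertex n k → Set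
TokenAdj G k (A , _) (B , _) = ∃[ u ] ∃[ v ] (Adj G u v × (A △ B) ≡ (⁅ u ⁆ ∪ ⁅ v ⁆))

countContaining : ∀ {n} → Subset n → List (Subset n) → ℕ
countContaining T Bs = length (filter (λ B → T ⊆? B) Bs)

IsDesign : (t v k λ' : ℕ) → List (Subset v) → Set
IsDesign t v k λ' Bs =
  Unique Bs ×
  All (λ B → ∣ B ∣ ≡ k) Bs ×
  (∀ (T : Subset v) → ∣ T ∣ ≡ t → countContaining T Bs ≡ λ')

module Submission where

-- Double counting.  Fix a maximum independent set I of T_k(G) and count the pairs (T, B)
-- with B ∈ I and T ⊆ B a (k-1)-subset.  Each block contains exactly k such T, so there
-- are k·α(T_k(G)) pairs.  The blocks containing a fixed T have the form T ∪ {x}, and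
-- T ∪ {x}, T ∪ {y} are adjacent in T_k(G) whenever x ~ y in G, so their points x form an
-- independent set of G: each of the C(n, k-1) sets T lies in at most α(G) blocks.
-- Equality forces every T to lie in exactly α(G) blocks, i.e. I is a design.

open import Algebra.Properties.CommutativeSemigroup using (interchange)
open import Data.Bool using (true; false; _∧_; _∨_; if_then_else_)
open import Data.Fin using (Fin; zero; suc)
open import Data.Fin.Subset
  using (Subset; _∩_; _∪_; ⁅_⁆; ∣_∣; _⊆_; _∉_; ⊥; inside; outside) renaming (_∈_ to _∈ₛ_)
open import Data.Fin.Subset.Properties
  using (_⊆?_; drop-∷-⊆; drop-there; p⊆q⇒∣p∣≤∣q∣; ∪-identityʳ; Empty-unique; x∈p∩q⁻;
         x∈⁅y⁆⇒x≡y; x≢y⇒x∉⁅y⁆)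
open import Data.List using (List; []; _∷_; [_]; length; filter; map; _++_)
open import Data.List.Membership.Propositional using (_∈_)
open import Data.List.Membership.Propositional.Properties using (∈-map⁺; ∈-++⁺ˡ; ∈-++⁺ʳ)
open import Data.List.Properties using (length-map; length-++; map-∘; map-++; map-cong)
open import Data.List.Relation.Unary.All as All using (All; []; _∷_)
import Data.List.Relation.Unary.All.Properties as All
open import Data.List.Relation.Unary.AllPairs as AllPairs using (AllPairs; []; _∷_)
import Data.List.Relation.Unary.AllPairs.Properties as AllPairs
import Data.List.Relation.Unary.Any as Any
import Data.List.Relation.Unary.Unique.Propositional.Properties as Unique
open import Data.Nat using (ℕ; zero; suc; _+_; _*_; _∸_; _≤_; z≤n; s≤s)
open import Data.Nat.Combinatorics using (_C_; nCk+nC[k+1]≡[n+1]C[k+1]; nCk≡nC[n∸k]; nC1≡n)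
open import Data.Nat.DivMod using (_/_)
open import Data.Nat.ListAction using (sum)
open import Data.Nat.ListAction.Properties using (sum-++)
open import Data.Nat.Properties
open import Data.Product using (∃-syntax; _×_; _,_; proj₁; proj₂)
open import Data.Vec as Vec using ([]; _∷_; here)
open import Data.Vec.Properties using (∷-injective)
open import Defs hiding (sym)
open import Function using (_∘_)
open import Relation.Binary.PropositionalEquality
  using (_≡_; _≢_; refl; sym; trans; cong; cong₂; subst; module ≡-Reasoning)
open import Relation.Nullary using (¬_; Dec; does)
open import Relation.Nullary.Negation using (contradiction)

private
  variable
    A B : Set
    n : ℕ

sum-map-zero : (xs : List A) → sum (map (λ _ → 0) xs) ≡ 0
sum-map-zero []       = refl
sum-map-zero (_ ∷ xs) = sum-map-zero xs

sum-map-+ : (f g : A → ℕ) (xs : List A) →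
  sum (map (λ x → f x + g x) xs) ≡ sum (map f xs) + sum (map g xs)
sum-map-+ f g []       = refl
sum-map-+ f g (x ∷ xs) = trans (cong (f x + g x +_) (sum-map-+ f g xs))
                               (interchange +-commutativeSemigroup (f x) (g x) (sum (map f xs)) (sum (map g xs)))

sum-map-swap : (f : A → B → ℕ) (xs : List A) (ys : List B) →
  sum (map (λ x → sum (map (f x) ys)) xs) ≡ sum (map (λ y → sum (map (λ x → f x y) xs)) ys)
sum-map-swap f []       ys = sym (sum-map-zero ys)
sum-map-swap f (x ∷ xs) ys =
  trans (cong (sum (map (f x) ys) +_) (sum-map-swap f xs ys))
        (sym (sum-map-+ (f x) (λ y → sum (map (λ x → f x y) xs)) ys))

sum-map-const : (f : A → ℕ) {c : ℕ} {xs : List A} →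
  All (λ x → f x ≡ c) xs → sum (map f xs) ≡ length xs * c
sum-map-const f []         = refl
sum-map-const f (fx≡c ∷ p) = cong₂ _+_ fx≡c (sum-map-const f p)

sum-map-≤ : (f : A → ℕ) {c : ℕ} {xs : List A} →
  All (λ x → f x ≤ c) xs → sum (map f xs) ≤ length xs * c
sum-map-≤ f []         = z≤n
sum-map-≤ f (fx≤c ∷ p) = +-mono-≤ fx≤c (sum-map-≤ f p)

sum-map-≤-tight : (f : A → ℕ) {c : ℕ} {xs : List A} → All (λ x → f x ≤ c) xs →
  sum (map f xs) ≡ length xs * c → All (λ x → f x ≡ c) xs
sum-map-≤-tight f []         _  = []
sum-map-≤-tight f {c} {x ∷ xs} (fx≤c ∷ p) eq =
  ≤-antisym fx≤c c≤fx ∷ sum-map-≤-tight f p (≤-antisym rest≤ rest≥)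
  where
  rest≤ : sum (map f xs) ≤ length xs * c
  rest≤ = sum-map-≤ f p
  c≤fx : c ≤ f x
  c≤fx = +-cancelʳ-≤ (length xs * c) c (f x)
           (≤-trans (≤-reflexive (sym eq)) (+-monoʳ-≤ (f x) rest≤))
  rest≥ : length xs * c ≤ sum (map f xs)
  rest≥ = +-cancelˡ-≤ c _ _
           (≤-trans (≤-reflexive (sym eq)) (+-monoˡ-≤ (sum (map f xs)) fx≤c))

sum-map-∘ : (f : B → ℕ) (g : A → B) (xs : List A) →
  sum (map f (map g xs)) ≡ sum (map (f ∘ g) xs)
sum-map-∘ f g xs = cong sum (sym (map-∘ xs))

indicator : {P : Set} → Dec P → ℕ
indicator d = if does d then 1 else 0

length-filter≡sum-indicator : {P : A → Set} (P? : ∀ x → Dec (P x)) (xs : List A) →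
  length (filter P? xs) ≡ sum (map (indicator ∘ P?) xs)
length-filter≡sum-indicator P? []       = refl
length-filter≡sum-indicator P? (x ∷ xs) with does (P? x)
... | true  = cong suc (length-filter≡sum-indicator P? xs)
... | false = length-filter≡sum-indicator P? xs

length-filter-map : {P : B → Set} (P? : ∀ y → Dec (P y)) (f : A → B) (xs : List A) →
  length (filter P? (map f xs)) ≡ length (filter (P? ∘ f) xs)
length-filter-map P? f []       = refl
length-filter-map P? f (x ∷ xs) with does (P? (f x))
... | true  = cong suc (length-filter-map P? f xs)
... | false = length-filter-map P? f xs

subsetsOfSize : (n j : ℕ) → List (Subset n)
subsetsOfSize zero    zero    = [ [] ]
subsetsOfSize zero    (suc j) = []
subsetsOfSize (suc n) zero    = map (outside ∷_) (subsetsOfSize n zero)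
subsetsOfSize (suc n) (suc j) =
  map (inside ∷_) (subsetsOfSize n j) ++ map (outside ∷_) (subsetsOfSize n (suc j))

length-subsetsOfSize : ∀ n j → length (subsetsOfSize n j) ≡ n C j
length-subsetsOfSize zero    zero    = refl
length-subsetsOfSize zero    (suc j) = refl
length-subsetsOfSize (suc n) zero    =
  trans (length-map (outside ∷_) (subsetsOfSize n zero)) (length-subsetsOfSize n zero)
length-subsetsOfSize (suc n) (suc j) = begin
  length (map (inside ∷_) Tᵢ ++ map (outside ∷_) Tₒ)         ≡⟨ length-++ (map (inside ∷_) Tᵢ) ⟩
  length (map (inside ∷_) Tᵢ) + length (map (outside ∷_) Tₒ) ≡⟨ cong₂ _+_ (length-map _ Tᵢ) (length-map _ Tₒ) ⟩
  length Tᵢ + length Tₒ                                       ≡⟨ cong₂ _+_ (length-subsetsOfSize n j)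
                                                                            (length-subsetsOfSize n (suc j)) ⟩
  n C j + n C suc j                                           ≡⟨ nCk+nC[k+1]≡[n+1]C[k+1] n j ⟩
  suc n C suc j                                               ∎
  where
  open ≡-Reasoning
  Tᵢ = subsetsOfSize n j
  Tₒ = subsetsOfSize n (suc j)

subsetsOfSize-size : ∀ n j → All (λ T → ∣ T ∣ ≡ j) (subsetsOfSize n j)
subsetsOfSize-size zero    zero    = refl ∷ []
subsetsOfSize-size zero    (suc j) = []
subsetsOfSize-size (suc n) zero    = All.map⁺ (subsetsOfSize-size n zero)
subsetsOfSize-size (suc n) (suc j) =
  All.++⁺ (All.map⁺ (All.map (cong suc) (subsetsOfSize-size n j)))
          (All.map⁺ (subsetsOfSize-size n (suc j)))

∈-subsetsOfSize : (T : Subset n) → T ∈ subsetsOfSize n ∣ T ∣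
∈-subsetsOfSize []            = Any.here refl
∈-subsetsOfSize (inside ∷ T)  = ∈-++⁺ˡ (∈-map⁺ (inside ∷_) (∈-subsetsOfSize T))
∈-subsetsOfSize {suc n} (outside ∷ T) with ∣ T ∣ | ∈-subsetsOfSize T
... | zero  | T∈ = ∈-map⁺ (outside ∷_) T∈
... | suc j | T∈ = ∈-++⁺ʳ (map (inside ∷_) (subsetsOfSize n j)) (∈-map⁺ (outside ∷_) T∈)

-- Relies on the definitional behaviour of _⊆?_: (outside ∷ T) ⊆? (b ∷ B) decides as T ⊆? B,
-- and (inside ∷ T) ⊆? (outside ∷ B) is a no.
sum-indicator-⊆-subsetsOfSize : (B : Subset n) (j : ℕ) →
  sum (map (λ T → indicator (T ⊆? B)) (subsetsOfSize n j)) ≡ ∣ B ∣ C j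
sum-indicator-⊆-subsetsOfSize []           zero    = refl
sum-indicator-⊆-subsetsOfSize []           (suc j) = refl
sum-indicator-⊆-subsetsOfSize (b ∷ B)      zero    =
  trans (sum-map-∘ (λ T → indicator (T ⊆? b ∷ B)) (outside ∷_) (subsetsOfSize _ zero))
        (sum-indicator-⊆-subsetsOfSize B zero)
sum-indicator-⊆-subsetsOfSize {suc n} (b ∷ B) (suc j) = begin
  sum (map ind (map (inside ∷_) Tᵢ ++ map (outside ∷_) Tₒ))
    ≡⟨ cong sum (map-++ ind (map (inside ∷_) Tᵢ) _) ⟩
  sum (map ind (map (inside ∷_) Tᵢ) ++ map ind (map (outside ∷_) Tₒ))
    ≡⟨ sum-++ (map ind (map (inside ∷_) Tᵢ)) _ ⟩
  sum (map ind (map (inside ∷_) Tᵢ)) + sum (map ind (map (outside ∷_) Tₒ))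
    ≡⟨ cong₂ _+_ (sum-map-∘ ind (inside ∷_) Tᵢ) (sum-map-∘ ind (outside ∷_) Tₒ) ⟩
  sum (map (ind ∘ (inside ∷_)) Tᵢ) + sum (map (ind ∘ (outside ∷_)) Tₒ)
    ≡⟨ cong (sum (map (ind ∘ (inside ∷_)) Tᵢ) +_) (sum-indicator-⊆-subsetsOfSize B (suc j)) ⟩
  sum (map (ind ∘ (inside ∷_)) Tᵢ) + ∣ B ∣ C suc j
    ≡⟨ step b ⟩
  ∣ b ∷ B ∣ C suc j ∎
  where
  open ≡-Reasoning
  ind : Subset (suc n) → ℕ
  ind T = indicator (T ⊆? b ∷ B)
  Tᵢ = subsetsOfSize n j
  Tₒ = subsetsOfSize n (suc j)
  step : ∀ b → sum (map (λ T → indicator (inside ∷ T ⊆? b ∷ B)) Tᵢ) + ∣ B ∣ C suc j ≡ ∣ b ∷ B ∣ C suc j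
  step inside  = trans (cong (_+ ∣ B ∣ C suc j) (sum-indicator-⊆-subsetsOfSize B j))
                       (nCk+nC[k+1]≡[n+1]C[k+1] ∣ B ∣ j)
  step outside = cong (_+ ∣ B ∣ C suc j) (sum-map-zero Tᵢ)

sum-countContaining-subsetsOfSize : (j : ℕ) (Bs : List (Subset n)) →
  sum (map (λ T → countContaining T Bs) (subsetsOfSize n j)) ≡ sum (map (λ B → ∣ B ∣ C j) Bs)
sum-countContaining-subsetsOfSize {n} j Bs = begin
  sum (map (λ T → countContaining T Bs) Ts)
    ≡⟨ cong sum (map-cong (λ T → length-filter≡sum-indicator (T ⊆?_) Bs) Ts) ⟩
  sum (map (λ T → sum (map (λ B → indicator (T ⊆? B)) Bs)) Ts)
    ≡⟨ sum-map-swap (λ T B → indicator (T ⊆? B)) Ts Bs ⟩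
  sum (map (λ B → sum (map (λ T → indicator (T ⊆? B)) Ts)) Bs)
    ≡⟨ cong sum (map-cong (λ B → sum-indicator-⊆-subsetsOfSize B j) Bs) ⟩
  sum (map (λ B → ∣ B ∣ C j) Bs) ∎
  where
  open ≡-Reasoning
  Ts = subsetsOfSize n j

[1+m]Cm≡1+m : ∀ m → suc m C m ≡ suc m
[1+m]Cm≡1+m m = begin
  suc m C m           ≡⟨ nCk≡nC[n∸k] (n≤1+n m) ⟩
  suc m C (suc m ∸ m) ≡⟨ cong (suc m C_) (m+n∸n≡m 1 m) ⟩
  suc m C 1           ≡⟨ nC1≡n (suc m) ⟩
  suc m               ∎
  where open ≡-Reasoning

sum-countContaining-uniform : (m : ℕ) {Bs : List (Subset n)} → All (λ B → ∣ B ∣ ≡ suc m) Bs →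
  sum (map (λ T → countContaining T Bs) (subsetsOfSize n m)) ≡ length Bs * suc m
sum-countContaining-uniform m {Bs} sizes =
  trans (sum-countContaining-subsetsOfSize m Bs)
        (sum-map-const (λ B → ∣ B ∣ C m)
          (All.map (λ ∣B∣≡1+m → trans (cong (_C m) ∣B∣≡1+m) ([1+m]Cm≡1+m m)) sizes))

p⊆q⇒∣p∣≡∣q∣⇒p≡q : {p q : Subset n} → p ⊆ q → ∣ p ∣ ≡ ∣ q ∣ → p ≡ q
p⊆q⇒∣p∣≡∣q∣⇒p≡q {p = []}          {[]}          _   _  = refl
p⊆q⇒∣p∣≡∣q∣⇒p≡q {p = inside ∷ p}  {inside ∷ q}  p⊆q eq =
  cong (inside ∷_) (p⊆q⇒∣p∣≡∣q∣⇒p≡q (drop-∷-⊆ p⊆q) (suc-injective eq))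
p⊆q⇒∣p∣≡∣q∣⇒p≡q {p = outside ∷ p} {outside ∷ q} p⊆q eq =
  cong (outside ∷_) (p⊆q⇒∣p∣≡∣q∣⇒p≡q (drop-∷-⊆ p⊆q) eq)
p⊆q⇒∣p∣≡∣q∣⇒p≡q {p = inside ∷ p}  {outside ∷ q} p⊆q _ with p⊆q here
... | ()
p⊆q⇒∣p∣≡∣q∣⇒p≡q {p = outside ∷ p} {inside ∷ q}  p⊆q eq =
  contradiction (p⊆q⇒∣p∣≤∣q∣ (drop-∷-⊆ p⊆q)) (<⇒≱ (≤-reflexive (sym eq)))

p⊆q⇒∣q∣≡1+∣p∣⇒q≡p∪⁅x⁆ : {p q : Subset n} → p ⊆ q → ∣ q ∣ ≡ suc ∣ p ∣ →
  ∃[ x ] x ∉ p × q ≡ p ∪ ⁅ x ⁆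
p⊆q⇒∣q∣≡1+∣p∣⇒q≡p∪⁅x⁆ {p = inside ∷ p} {inside ∷ q} p⊆q eq
  with x , x∉p , q≡p∪⁅x⁆ ← p⊆q⇒∣q∣≡1+∣p∣⇒q≡p∪⁅x⁆ (drop-∷-⊆ p⊆q) (suc-injective eq)
  = suc x , x∉p ∘ drop-there , cong (inside ∷_) q≡p∪⁅x⁆
p⊆q⇒∣q∣≡1+∣p∣⇒q≡p∪⁅x⁆ {p = outside ∷ p} {outside ∷ q} p⊆q eq
  with x , x∉p , q≡p∪⁅x⁆ ← p⊆q⇒∣q∣≡1+∣p∣⇒q≡p∪⁅x⁆ (drop-∷-⊆ p⊆q) eq
  = suc x , x∉p ∘ drop-there , cong (outside ∷_) q≡p∪⁅x⁆
p⊆q⇒∣q∣≡1+∣p∣⇒q≡p∪⁅x⁆ {p = inside ∷ p}  {outside ∷ q} p⊆q _ with p⊆q here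
... | ()
p⊆q⇒∣q∣≡1+∣p∣⇒q≡p∪⁅x⁆ {p = outside ∷ p} {inside ∷ q}  p⊆q eq =
  zero , (λ ()) ,
  cong (inside ∷_) (trans (sym (p⊆q⇒∣p∣≡∣q∣⇒p≡q (drop-∷-⊆ p⊆q) (sym (suc-injective eq))))
                          (sym (∪-identityʳ p)))

x∉p⇒p∩⁅x⁆≡⊥ : {x : Fin n} {p : Subset n} → x ∉ p → p ∩ ⁅ x ⁆ ≡ ⊥
x∉p⇒p∩⁅x⁆≡⊥ {x = x} {p} x∉p = Empty-unique λ (y , y∈p∩⁅x⁆) →
  let y∈p , y∈⁅x⁆ = x∈p∩q⁻ p ⁅ x ⁆ y∈p∩⁅x⁆
  in x∉p (subst (_∈ₛ p) (x∈⁅y⁆⇒x≡y x y∈⁅x⁆) y∈p)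

∪-△-∪ : {p q r : Subset n} → p ∩ q ≡ ⊥ → p ∩ r ≡ ⊥ → q ∩ r ≡ ⊥ → (p ∪ q) △ (p ∪ r) ≡ q ∪ r
∪-△-∪ {p = []} {[]} {[]} _ _ _ = refl
∪-△-∪ {p = s ∷ p} {t ∷ q} {u ∷ r} pq pr qr
  with s∧t , pq′ ← ∷-injective pq | s∧u , pr′ ← ∷-injective pr | t∧u , qr′ ← ∷-injective qr
  = cong₂ _∷_ (head s t u s∧t s∧u t∧u) (∪-△-∪ pq′ pr′ qr′)
  where
  head : ∀ s t u → s ∧ t ≡ false → s ∧ u ≡ false → t ∧ u ≡ false →
         Vec.head (((s ∷ []) ∪ (t ∷ [])) △ ((s ∷ []) ∪ (u ∷ []))) ≡ t ∨ u
  head false false false _ _ _ = refl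
  head false false true  _ _ _ = refl
  head false true  false _ _ _ = refl
  head false true  true  _ _ ()
  head true  false false _ _ _ = refl
  head true  false true  _ () _
  head true  true  _     () _ _

module _ {P : A → Set} (f : ∀ {x} → P x → B) where

  length-reduce : {xs : List A} (pxs : All P xs) → length (All.reduce f pxs) ≡ length xs
  length-reduce []         = refl
  length-reduce (_ ∷ pxs)  = cong suc (length-reduce pxs)

  AllPairs-reduce : {R : A → A → Set} {S : B → B → Set} →
    (∀ {x y} (px : P x) (py : P y) → R x y → S (f px) (f py)) →
    {xs : List A} (pxs : All P xs) → AllPairs R xs → AllPairs S (All.reduce f pxs)
  AllPairs-reduce {R} {S} f-resp = go
    where
    head : ∀ {x xs} (px : P x) (pxs : All P xs) → All (R x) xs → All (S (f px)) (All.reduce f pxs)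
    head px []         []           = []
    head px (py ∷ pys) (Rxy ∷ Rxys) = f-resp px py Rxy ∷ head px pys Rxys
    go : {xs : List A} (pxs : All P xs) → AllPairs R xs → AllPairs S (All.reduce f pxs)
    go []         []           = []
    go (px ∷ pxs) (Rx ∷ Rxs)   = head px pxs Rx ∷ go pxs Rxs

TokenVertex-≡ : {k : ℕ} {v w : TokenVertex n k} → proj₁ v ≡ proj₁ w → v ≡ w
TokenVertex-≡ {v = A , p} {.A , q} refl = cong (A ,_) (≡-irrelevant p q)

module _ (G : Graph n) {k : ℕ} where

  ∪⁅⁆-tokenAdj : {T : Subset n} {x y : Fin n} {v w : TokenVertex n k} → x ∉ T → y ∉ T →
    proj₁ v ≡ T ∪ ⁅ x ⁆ → proj₁ w ≡ T ∪ ⁅ y ⁆ → Adj G x y → TokenAdj G k v w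
  ∪⁅⁆-tokenAdj {T} {x} {y} {v} {w} x∉T y∉T v≡T∪⁅x⁆ w≡T∪⁅y⁆ x~y = x , y , x~y , (begin
    proj₁ v △ proj₁ w               ≡⟨ cong₂ _△_ v≡T∪⁅x⁆ w≡T∪⁅y⁆ ⟩
    (T ∪ ⁅ x ⁆) △ (T ∪ ⁅ y ⁆)       ≡⟨ ∪-△-∪ (x∉p⇒p∩⁅x⁆≡⊥ x∉T) (x∉p⇒p∩⁅x⁆≡⊥ y∉T)
                                          (x∉p⇒p∩⁅x⁆≡⊥ (x≢y⇒x∉⁅y⁆ y≢x)) ⟩
    ⁅ x ⁆ ∪ ⁅ y ⁆                   ∎)
    where
    open ≡-Reasoning
    y≢x : y ≢ x
    y≢x y≡x = irrefl G (subst (Adj G x) y≡x x~y)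

  countContaining≤α : {a : ℕ} {T : Subset n} {I : List (TokenVertex n k)} →
    IsIndependenceNumber (Adj G) a → IsIndependentSet (TokenAdj G k) I → suc ∣ T ∣ ≡ k →
    countContaining T (map proj₁ I) ≤ a
  countContaining≤α {a} {T} {I} (_ , α-maximal) (I-unique , I-independent) 1+∣T∣≡k = begin
    countContaining T (map proj₁ I)  ≡⟨ length-filter-map (T ⊆?_) proj₁ I ⟩
    length Iᵀ                        ≡⟨ length-reduce proj₁ extensions ⟨
    length xs                        ≤⟨ α-maximal xs (AllPairs.unzip xs-independent) ⟩
    a                                ∎
    where
    open ≤-Reasoning
    T⊆? : (v : TokenVertex n k) → Dec (T ⊆ proj₁ v)
    T⊆? v = T ⊆? proj₁ v
    Iᵀ = filter T⊆? I
    Extension : TokenVertex n k → Set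
    Extension v = ∃[ x ] x ∉ T × proj₁ v ≡ T ∪ ⁅ x ⁆
    extensions : All Extension Iᵀ
    extensions = All.map (λ {v} → extension {v}) (All.all-filter {P = λ v → T ⊆ proj₁ v} T⊆? I)
      where
      extension : ∀ {v} → T ⊆ proj₁ v → Extension v
      extension {v} T⊆v = p⊆q⇒∣q∣≡1+∣p∣⇒q≡p∪⁅x⁆ T⊆v (trans (proj₂ v) (sym 1+∣T∣≡k))
    xs = All.reduce proj₁ extensions
    extension-independent : ∀ {v w} (ev : Extension v) (ew : Extension w) →
      v ≢ w × ¬ TokenAdj G k v w → proj₁ ev ≢ proj₁ ew × ¬ Adj G (proj₁ ev) (proj₁ ew)
    extension-independent {v} {w} (x , x∉T , v≡T∪⁅x⁆) (y , y∉T , w≡T∪⁅y⁆) (v≢w , v≁w) =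
      (λ x≡y → v≢w (TokenVertex-≡ (trans v≡T∪⁅x⁆ (trans (cong (λ z → T ∪ ⁅ z ⁆) x≡y) (sym w≡T∪⁅y⁆))))) ,
      (λ x~y → v≁w (∪⁅⁆-tokenAdj {v = v} {w} x∉T y∉T v≡T∪⁅x⁆ w≡T∪⁅y⁆ x~y))
    xs-independent : AllPairs (λ x y → x ≢ y × ¬ Adj G x y) xs
    xs-independent = AllPairs-reduce {P = Extension} proj₁ extension-independent extensions
      (AllPairs.filter⁺ T⊆? (AllPairs.zip (I-unique , I-independent)))

theorem2p1 : ∀ (n : ℕ) (G : Graph n) → NoIsolatedVertices G →
    ∀ (k : ℕ) → 1 ≤ k → k ≤ n / 2 →
    ∀ (a b : ℕ) → IsIndependenceNumber (Adj G) a →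
      IsIndependenceNumber (TokenAdj G k) b →
      (k * b ≤ (n C (k ∸ 1)) * a) ×
      (k * b ≡ (n C (k ∸ 1)) * a → ∃[ Bs ] IsDesign (k ∸ 1) n k a Bs)
theorem2p1 n G _ (suc m) (s≤s z≤n) _ a b α-G ((I , I-independent , ∣I∣≡b) , _) = bound , design
  where
  Bs = map proj₁ I
  Ts = subsetsOfSize n m
  count : Subset n → ℕ
  count T = countContaining T Bs
  count≤a : All (λ T → count T ≤ a) Ts
  count≤a = All.map (λ ∣T∣≡m → countContaining≤α G α-G I-independent (cong suc ∣T∣≡m))
                    (subsetsOfSize-size n m)
  incidences : sum (map count Ts) ≡ suc m * b
  incidences = trans (sum-countContaining-uniform m (All.map⁺ (All.universal proj₂ I)))
                     (trans (cong (_* suc m) (trans (length-map proj₁ I) ∣I∣≡b)) (*-comm b (suc m)))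
  ∣Ts∣*a : length Ts * a ≡ (n C m) * a
  ∣Ts∣*a = cong (_* a) (length-subsetsOfSize n m)
  bound : suc m * b ≤ (n C m) * a
  bound = begin
    suc m * b          ≡⟨ incidences ⟨
    sum (map count Ts) ≤⟨ sum-map-≤ count count≤a ⟩
    length Ts * a      ≡⟨ ∣Ts∣*a ⟩
    (n C m) * a        ∎
    where open ≤-Reasoning
  design : suc m * b ≡ (n C m) * a → ∃[ Bs ] IsDesign m n (suc m) a Bs
  design tight =
    Bs , Unique.map⁺ TokenVertex-≡ (proj₁ I-independent) , All.map⁺ (All.universal proj₂ I) ,
    λ T ∣T∣≡m → All.lookup count≡a (subst (λ j → T ∈ subsetsOfSize n j) ∣T∣≡m (∈-subsetsOfSize T))
    where
    count≡a : All (λ T → count T ≡ a) Ts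
    count≡a = sum-map-≤-tight count count≤a (trans incidences (trans tight (sym ∣Ts∣*a)))
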